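{- Let $q$ be a prime power, $F=\mathrm{GF}(q)$, $m\ge 2$, $n=\frac{q^m-1}{q-1}$, and let $\mathfrak{A}$, $\bar e^{(\delta)}$, $R_\delta$, $\Omega$ be as in the context. Let $\delta\in\mathfrak{A}$. Then for every $\bar z\in F^n$ and every $\mu\in F$, $$\Omega(R_\delta+\bar z)=\Omega(R_\delta+\bar z+\mu\bar e^{(\delta)}).$$
   Context: $\mathfrak{A}\subset F^m$ is the set of nonzero vectors whose first nonzero entry equals $1$ (so $|\mathfrak{A}|=n$), and the coordinates of $F^n$ are indexed by $\mathfrak{A}$. The Hamming code is $\mathcal H_m=\{\bar c\in F^n\mid \sum_{\alpha\in\mathfrak{A}}c_\alpha\alpha=0^m\}$. For $\delta\in\mathfrak{A}$, $\bar e^{(\delta)}$ is the unit vector of $F^n$ with $1$ in coordinate $\delta$; $T_\delta$ is the set of $\bar c\in\mathcal H_m$ with exactly three nonzero coordinates and $c_\delta=1$; $R_\delta$ is the linear span of $T_\delta$. The Hamming distance is the number of positions in which two vectors differ, and for $M\subset F^n$, $\Omega(M)$ is the set of vectors at Hamming distance at most $1$ from some element of $M$. -}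

module Defs where

open import Level using (Level; _⊔_) renaming (suc to lsuc)
open import Data.Nat as ℕ using (ℕ; zero; suc)
open import Data.Fin as Fin using (Fin)
open import Data.Fin.Properties as FinP using ()
open import Data.List using (List; []; _∷_; map; concatMap; filter; length; lookup; foldr)
open import Data.List.Relation.Unary.All using (All)
open import Data.Vec.Functional as VF using (Vector)
open import Data.Product using (Σ; ∃; _×_; _,_; proj₁; proj₂)
open import Data.Empty using (⊥)
open import Relation.Nullary using (¬_; Dec; yes; no; ¬?)
open import Relation.Nullary.Decidable using (map′)
open import Relation.Binary.PropositionalEquality as ≡ using (_≡_)
open import Algebra.Bundles using (CommutativeRing)
open import Function.Bundles using (Inverse)
open import Data.List using (allFin)

record FiniteField (c ℓ : Level) : Set (lsuc (c ⊔ ℓ)) where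
  field
    commRing : CommutativeRing c ℓ
  open CommutativeRing commRing public
  field
    0≉1     : ¬ (0# ≈ 1#)
    inv     : ∀ x → ¬ (x ≈ 0#) → Σ Carrier (λ y → (x * y) ≈ 1#)
    q       : ℕ
    enum    : Inverse setoid (≡.setoid (Fin q))

  open Inverse enum public using (to; from; to-cong; strictlyInverseʳ)

  _≟_ : ∀ x y → Dec (x ≈ y)
  x ≟ y = map′ (λ p → trans (sym (strictlyInverseʳ x))
                          (trans (reflexive (≡.cong from p)) (strictlyInverseʳ y)))
               to-cong (to x FinP.≟ to y)

module Hamming {c ℓ : Level} (F : FiniteField c ℓ) (m : ℕ) where
  open FiniteField F

  elems : List Carrier
  elems = map from (allFin q)

  vecs : (k : ℕ) → List (Vector Carrier k)
  vecs zero    = (λ ()) ∷ []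
  vecs (suc k) = concatMap (λ x → map (λ v → x VF.∷ v) (vecs k)) elems

  Normalised : {k : ℕ} → Vector Carrier k → Set ℓ
  Normalised {zero}  v = Level.Lift ℓ ⊥
  Normalised {suc k} v with v Fin.zero ≟ 0#
  ... | yes _ = Normalised {k} (VF.tail v)
  ... | no  _ = v Fin.zero ≈ 1#

  normalised? : {k : ℕ} → (v : Vector Carrier k) → Dec (Normalised v)
  normalised? {zero}  v = no (λ ())
  normalised? {suc k} v with v Fin.zero ≟ 0#
  ... | yes _ = normalised? (VF.tail v)
  ... | no  _ = v Fin.zero ≟ 1#

  𝔄 : List (Vector Carrier m)
  𝔄 = filter normalised? (vecs m)

  -- n = |𝔄|; coordinates of F^n are indexed by 𝔄 via  i ↦ α i
  n : ℕ
  n = length 𝔄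

  α : Fin n → Vector Carrier m
  α = lookup 𝔄

  Word : Set c
  Word = Fin n → Carrier

  Σᶠ : (Fin n → Carrier) → Carrier
  Σᶠ f = foldr (λ i s → f i + s) 0# (allFin n)

  syndrome : Word → Vector Carrier m
  syndrome w j = Σᶠ (λ i → w i * α i j)

  InHamming : Word → Set ℓ
  InHamming w = ∀ j → syndrome w j ≈ 0#

  countᶠ : {p : Level} {P : Fin n → Set p} → (∀ i → Dec (P i)) → ℕ
  countᶠ P? = length (filter P? (allFin n))

  weight : Word → ℕ
  weight w = countᶠ (λ i → ¬? (w i ≟ 0#))

  dist : Word → Word → ℕ
  dist x y = countᶠ (λ i → ¬? (x i ≟ y i))

  e : Fin n → Word
  e δ i with δ FinP.≟ i
  ... | yes _ = 1#
  ... | no  _ = 0#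

  _⊕_ : Word → Word → Word
  (x ⊕ y) i = x i + y i

  _·_ : Carrier → Word → Word
  (μ · x) i = μ * x i

  𝟎 : Word
  𝟎 i = 0#

  T : Fin n → Word → Set ℓ
  T δ w = InHamming w × weight w ≡ 3 × w δ ≈ 1#

  linComb : List (Carrier × Word) → Word
  linComb []             = 𝟎
  linComb ((a , t) ∷ ts) = (a · t) ⊕ linComb ts

  R : Fin n → Word → Set (c ⊔ ℓ)
  R δ w = ∃ λ (ts : List (Carrier × Word)) →
            All (λ p → T δ (proj₂ p)) ts × (∀ i → w i ≈ linComb ts i)

  _+ˢ_ : (Word → Set (c ⊔ ℓ)) → Word → (Word → Set (c ⊔ ℓ))
  (M +ˢ z) w = ∃ λ r → M r × (∀ i → w i ≈ r i + z i)

  Ω : (Word → Set (c ⊔ ℓ)) → (Word → Set (c ⊔ ℓ))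
  Ω M x = ∃ λ y → M y × dist x y ℕ.≤ 1

module Submission where

-- By symmetry (shift back by -μ) one inclusion suffices.  Let x lie within
-- distance one of y = r + z with r ∈ R_δ, say x and y agree off coordinate a.
-- If a = δ, or μ = 0, or x = y, then x is within distance one of r + z + μē^(δ)
-- already.  Otherwise put ν = -μ and λ = x_a - y_a ≠ 0.  The heart of the proof
-- is the existence of a weight-three codeword t = ē^(δ) + β ē^(a) + γ ē^(b) of
-- the Hamming code with prescribed β = λ/ν ≠ 0 (the columns α_δ + β α_a and α_b
-- are proportional).  Then t ∈ T_δ, r + νt ∈ R_δ, and r + νt + z + μē^(δ)
-- agrees with x everywhere except possibly at b.

open import Defs
open import Level using (Level; lift)
open import Data.Nat as ℕ using (ℕ; zero; suc; _≤_; z≤n)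
import Data.Nat.Properties as ℕP
open import Data.Fin as Fin using (Fin)
import Data.Fin.Properties as FinP
open import Data.Product using (∃; _×_; _,_; proj₁; proj₂)
open import Data.Sum using (_⊎_; inj₁; inj₂; [_,_]′)
open import Data.Empty using (⊥; ⊥-elim)
open import Relation.Nullary using (¬_; Dec; yes; no; ¬?)
open import Relation.Nullary.Decidable using (_⊎-dec_; decidable-stable)
open import Relation.Unary using (Pred; Decidable)
open import Relation.Binary.Definitions using (DecidableEquality)
open import Relation.Binary.PropositionalEquality as ≡ using (_≡_; _≢_; ≢-sym)
open import Relation.Binary.Bundles using (Setoid)
open import Function.Bundles using (_⇔_; mk⇔; Inverse)
open import Data.Vec.Functional as VF using (Vector)
open import Data.List
  using (List; []; _∷_; map; concatMap; filter; length; lookup; allFin; cartesianProductWith; _++_; foldr)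
open import Data.List.Properties using (filter-none; filter-some; filter-≐)
open import Data.List.Relation.Unary.Any as Any using (Any; here; there)
import Data.List.Relation.Unary.Any.Properties as AnyP
open import Data.List.Relation.Unary.All as All using (All; []; _∷_)
open import Data.List.Relation.Unary.All.Properties using (all-filter; ¬Any⇒All¬)
open import Data.List.Relation.Unary.AllPairs using ([]; _∷_)
import Data.List.Relation.Unary.Unique.Setoid as SetoidUnique
import Data.List.Relation.Unary.Unique.Setoid.Properties as SetoidUniqueP
open import Data.List.Relation.Unary.Unique.Propositional using (Unique)
open import Data.List.Relation.Unary.Unique.Propositional.Properties using (allFin⁺)
open import Data.List.Membership.Propositional using (_∈_)
open import Data.List.Membership.Propositional.Properties using (∈-allFin; ∈-lookup)
import Data.Vec.Functional.Relation.Binary.Equality.Setoid as VecEquality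

module Counting {a p : Level} {A : Set a} {P : Pred A p} (P? : Decidable P) where

  count : List A → ℕ
  count xs = length (filter P? xs)

  count-none : ∀ {xs} → All (λ x → ¬ P x) xs → count xs ≡ 0
  count-none ¬Ps = ≡.cong length (filter-none P? ¬Ps)

  count≡0⇒none : ∀ xs → count xs ≡ 0 → All (λ x → ¬ P x) xs
  count≡0⇒none xs count≡0 =
    ¬Any⇒All¬ xs (λ some → ℕP.<⇒≢ (filter-some P? some) (≡.sym count≡0))

  count≤1⇒single-candidate : A → ∀ xs → count xs ≤ 1 → ∃ λ c → All (λ x → x ≢ c → ¬ P x) xs
  count≤1⇒single-candidate d [] _ = d , []
  count≤1⇒single-candidate d (x ∷ xs) count≤1 with P? x
  ... | yes _ = x , (λ x≢x → ⊥-elim (x≢x ≡.refl))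
                  ∷ All.map (λ ¬Py _ → ¬Py) (count≡0⇒none xs (ℕP.n≤0⇒n≡0 (ℕP.≤-pred count≤1)))
  ... | no ¬Px with count≤1⇒single-candidate d xs count≤1
  ...   | c , others = c , (λ _ → ¬Px) ∷ others

  single-candidate⇒count≤1 : ∀ {xs} → Unique xs → (c : A) → (∀ x → x ≢ c → ¬ P x) → count xs ≤ 1
  single-candidate⇒count≤1 {[]} _ c only-c = z≤n
  single-candidate⇒count≤1 {x ∷ xs} (x∉xs ∷ xs!) c only-c with P? x
  ... | no _ = single-candidate⇒count≤1 xs! c only-c
  ... | yes Px = ℕP.≤-reflexive (≡.cong suc (count-none (All.map others x∉xs)))
    where
      others : ∀ {y} → x ≢ y → ¬ P y
      others x≢y = only-c _ (λ y≡c → only-c x (λ x≡c → x≢y (≡.trans x≡c (≡.sym y≡c))) Px)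

open Counting using (count; count-none; count≤1⇒single-candidate; single-candidate⇒count≤1)

count-⊎ : ∀ {a p q} {A : Set a} {P : Pred A p} {Q : Pred A q} (P? : Decidable P) (Q? : Decidable Q) →
          (∀ x → P x → Q x → ⊥) → ∀ xs →
          count (λ x → P? x ⊎-dec Q? x) xs ≡ count P? xs ℕ.+ count Q? xs
count-⊎ P? Q? disjoint [] = ≡.refl
count-⊎ P? Q? disjoint (x ∷ xs) with P? x | Q? x
... | yes Px | yes Qx = ⊥-elim (disjoint x Px Qx)
... | yes _  | no _   = ≡.cong suc (count-⊎ P? Q? disjoint xs)
... | no _   | yes _  = ≡.trans (≡.cong suc (count-⊎ P? Q? disjoint xs)) (≡.sym (ℕP.+-suc _ _))
... | no _   | no _   = count-⊎ P? Q? disjoint xs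

count-≡ : ∀ {a} {A : Set a} (_≟_ : DecidableEquality A) {d : A} {xs} →
          Unique xs → d ∈ xs → count (_≟ d) xs ≡ 1
count-≡ _≟_ {d} (d∉xs ∷ _) (here ≡.refl) with d ≟ d
... | yes _   = ≡.cong suc (count-none (_≟ d) (All.map (λ d≢y y≡d → d≢y (≡.sym y≡d)) d∉xs))
... | no d≢d = ⊥-elim (d≢d ≡.refl)
count-≡ _≟_ {d} {x ∷ _} (x∉xs ∷ xs!) (there d∈xs) with x ≟ d
... | yes ≡.refl = ⊥-elim (All.lookup x∉xs d∈xs ≡.refl)
... | no _       = count-≡ _≟_ xs! d∈xs

lookup-distinct : ∀ {a ℓ} (S : Setoid a ℓ) {xs} → SetoidUnique.Unique S xs →
                  ∀ i j → i ≢ j → ¬ Setoid._≈_ S (lookup xs i) (lookup xs j)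
lookup-distinct S (x∉xs ∷ xs!) Fin.zero    Fin.zero    0≢0 = ⊥-elim (0≢0 ≡.refl)
lookup-distinct S (x∉xs ∷ xs!) Fin.zero    (Fin.suc j) _   = All.lookup x∉xs (∈-lookup j)
lookup-distinct S (x∉xs ∷ xs!) (Fin.suc i) Fin.zero    _   =
  λ eq → All.lookup x∉xs (∈-lookup i) (Setoid.sym S eq)
lookup-distinct S (x∉xs ∷ xs!) (Fin.suc i) (Fin.suc j) i≢j =
  lookup-distinct S xs! i j (λ i≡j → i≢j (≡.cong Fin.suc i≡j))

concatMap≡cartesianProductWith : ∀ {a b c} {A : Set a} {B : Set b} {C : Set c}
  (g : A → B → C) (xs : List A) (ys : List B) →
  concatMap (λ x → map (g x) ys) xs ≡ cartesianProductWith g xs ys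
concatMap≡cartesianProductWith g [] ys = ≡.refl
concatMap≡cartesianProductWith g (x ∷ xs) ys =
  ≡.cong (map (g x) ys ++_) (concatMap≡cartesianProductWith g xs ys)

module CosetNeighbourhoods {c ℓ : Level} (F : FiniteField c ℓ) (m : ℕ) where
  open FiniteField F
  open Hamming F m
  open import Relation.Binary.Reasoning.Setoid setoid
  open import Algebra.Properties.Ring ring using (-‿distribˡ-*; -‿distribʳ-*; -1*x≈-x)
  open import Algebra.Properties.CommutativeSemigroup +-commutativeSemigroup
    using (interchange; xy∙z≈xz∙y; x∙yz≈y∙xz)
  open import Algebra.Properties.AbelianGroup +-abelianGroup using (inverseʳ-unique; x∙y⁻¹≈ε⇒x≈y)
  open VecEquality setoid using (_≋_; ≋-setoid)

  inverse-cancelˡ : ∀ {x y} a → x * y ≈ 1# → y * (x * a) ≈ a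
  inverse-cancelˡ {x} {y} a xy≈1 = begin
    y * (x * a) ≈⟨ *-assoc y x a ⟨
    (y * x) * a ≈⟨ *-congʳ (trans (*-comm y x) xy≈1) ⟩
    1# * a      ≈⟨ *-identityˡ a ⟩
    a           ∎

  inverse-cancelʳ : ∀ {x y} a → x * y ≈ 1# → x * (y * a) ≈ a
  inverse-cancelʳ {x} {y} a xy≈1 = inverse-cancelˡ a (trans (*-comm y x) xy≈1)

  inverse-nonzero : ∀ {x y} → x * y ≈ 1# → ¬ y ≈ 0#
  inverse-nonzero {x} xy≈1 y≈0 = 0≉1 (trans (sym (trans (*-congˡ y≈0) (zeroʳ x))) xy≈1)

  no-zero-divisors : ∀ {x y} → x * y ≈ 0# → ¬ x ≈ 0# → y ≈ 0#
  no-zero-divisors {x} {y} xy≈0 x≉0 =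
    let (x⁻¹ , xx⁻¹≈1) = inv x x≉0
    in trans (sym (inverse-cancelˡ y xx⁻¹≈1)) (trans (*-congˡ xy≈0) (zeroʳ x⁻¹))

  -‿nonzero : ∀ {x} → ¬ x ≈ 0# → ¬ - x ≈ 0#
  -‿nonzero {x} x≉0 -x≈0 = x≉0 (trans (sym (+-identityʳ x)) (trans (+-congˡ (sym -x≈0)) (-‿inverseʳ x)))

  -- Normalised vectors: the representatives 𝔄 of the points of projective space.

  normalised-via-tail : ∀ {k} (u : Vector Carrier (suc k)) → u Fin.zero ≈ 0# →
                        Normalised (VF.tail u) → Normalised u
  normalised-via-tail u u₀≈0 normal with u Fin.zero ≟ 0#
  ... | yes _   = normal
  ... | no u₀≉0 = ⊥-elim (u₀≉0 u₀≈0)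

  normalised-via-head : ∀ {k} (u : Vector Carrier (suc k)) → ¬ u Fin.zero ≈ 0# →
                        u Fin.zero ≈ 1# → Normalised u
  normalised-via-head u u₀≉0 u₀≈1 with u Fin.zero ≟ 0#
  ... | yes u₀≈0 = ⊥-elim (u₀≉0 u₀≈0)
  ... | no _     = u₀≈1

  normalised⇒nonzero : ∀ {k} (u : Vector Carrier k) → Normalised u → ∃ λ j → ¬ u j ≈ 0#
  normalised⇒nonzero {zero} u (lift ())
  normalised⇒nonzero {suc k} u nu with u Fin.zero ≟ 0#
  ... | yes _   = let (j , uj≉0) = normalised⇒nonzero (VF.tail u) nu in Fin.suc j , uj≉0
  ... | no u₀≉0 = Fin.zero , u₀≉0

  normalised-resp : ∀ {k} {u w : Vector Carrier k} → u ≋ w → Normalised u → Normalised w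
  normalised-resp {zero} _ (lift ())
  normalised-resp {suc k} {u} {w} u≋w nu with u Fin.zero ≟ 0#
  ... | yes u₀≈0 = normalised-via-tail w (trans (sym (u≋w Fin.zero)) u₀≈0)
                     (normalised-resp (λ i → u≋w (Fin.suc i)) nu)
  ... | no u₀≉0  = normalised-via-head w (λ w₀≈0 → u₀≉0 (trans (u≋w Fin.zero) w₀≈0))
                     (trans (sym (u≋w Fin.zero)) nu)

  normalise : ∀ {k} (v : Vector Carrier k) (j : Fin k) → ¬ v j ≈ 0# →
              ∃ λ s → ¬ s ≈ 0# × Normalised (λ i → s * v i)
  normalise {suc k} v j vj≉0 with v Fin.zero ≟ 0#
  normalise {suc k} v Fin.zero    vj≉0 | yes v₀≈0 = ⊥-elim (vj≉0 v₀≈0)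
  normalise {suc k} v (Fin.suc j) vj≉0 | yes v₀≈0 =
    let (s , s≉0 , normal) = normalise (VF.tail v) j vj≉0
    in s , s≉0 , normalised-via-tail (λ i → s * v i) (trans (*-congˡ v₀≈0) (zeroʳ s)) normal
  normalise {suc k} v j _ | no v₀≉0 =
    let (s , v₀s≈1) = inv (v Fin.zero) v₀≉0
        sv₀≈1 = trans (*-comm s (v Fin.zero)) v₀s≈1
    in s , inverse-nonzero v₀s≈1
         , normalised-via-head (λ i → s * v i) (λ sv₀≈0 → 0≉1 (trans (sym sv₀≈0) sv₀≈1)) sv₀≈1

  factor-at-one : ∀ {s u₀ w₀} → w₀ ≈ 1# → u₀ ≈ s * w₀ → s ≈ u₀
  factor-at-one {s} w₀≈1 u₀≈sw₀ = trans (sym (*-identityʳ s)) (trans (*-congˡ (sym w₀≈1)) (sym u₀≈sw₀))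

  normalised-proportional : ∀ {k} {u w : Vector Carrier k} s → Normalised u → Normalised w →
                            (∀ i → u i ≈ s * w i) → u ≋ w
  normalised-proportional {zero} s (lift ()) _ _
  normalised-proportional {suc k} {u} {w} s nu nw u≈sw with u Fin.zero ≟ 0# | w Fin.zero ≟ 0#
  ... | yes u₀≈0 | yes w₀≈0 = λ
    { Fin.zero    → trans u₀≈0 (sym w₀≈0)
    ; (Fin.suc i) → normalised-proportional s nu nw (λ i → u≈sw (Fin.suc i)) i }
  ... | yes u₀≈0 | no _ =
    let (j , uj≉0) = normalised⇒nonzero (VF.tail u) nu
        s≈0 = trans (factor-at-one nw (u≈sw Fin.zero)) u₀≈0
    in ⊥-elim (uj≉0 (trans (u≈sw (Fin.suc j)) (trans (*-congʳ s≈0) (zeroˡ _))))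
  ... | no u₀≉0 | yes w₀≈0 = ⊥-elim (u₀≉0 (trans (u≈sw Fin.zero) (trans (*-congˡ w₀≈0) (zeroʳ s))))
  ... | no _ | no _ = λ i → trans (u≈sw i) (trans (*-congʳ s≈1) (*-identityˡ _))
    where
      s≈1 : s ≈ 1#
      s≈1 = trans (factor-at-one nw (u≈sw Fin.zero)) nu

  elems-complete : ∀ x → Any (_≈ x) elems
  elems-complete x = AnyP.map⁺ (Any.map (λ { ≡.refl → strictlyInverseʳ x }) (∈-allFin (to x)))

  vecs-complete : ∀ k (u : Vector Carrier k) → Any (_≋ u) (vecs k)
  vecs-complete zero    u = here (λ ())
  vecs-complete (suc k) u = AnyP.concatMap⁺ _
    (Any.map (λ x≈u₀ → AnyP.map⁺ (Any.map (cons-≋ x≈u₀) (vecs-complete k (VF.tail u))))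
             (elems-complete (u Fin.zero)))
    where
      cons-≋ : ∀ {x v} → x ≈ u Fin.zero → v ≋ VF.tail u → (x VF.∷ v) ≋ u
      cons-≋ x≈u₀ _    Fin.zero    = x≈u₀
      cons-≋ _    v≋u₁ (Fin.suc i) = v≋u₁ i

  elems-unique : SetoidUnique.Unique setoid elems
  elems-unique = SetoidUniqueP.map⁺ (≡.setoid (Fin q)) setoid from-injective
                   (SetoidUniqueP.tabulate⁺ (≡.setoid (Fin q)) {f = λ i → i} (λ i≡j → i≡j))
    where
      from-injective : ∀ {i j} → from i ≈ from j → i ≡ j
      from-injective {i} {j} eq = ≡.trans (≡.sym (Inverse.strictlyInverseˡ enum i))
                                    (≡.trans (to-cong eq) (Inverse.strictlyInverseˡ enum j))

  vecs-unique : ∀ k → SetoidUnique.Unique (≋-setoid k) (vecs k)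
  vecs-unique zero = [] ∷ []
  vecs-unique (suc k) rewrite concatMap≡cartesianProductWith (λ x v → x VF.∷ v) elems (vecs k) =
    SetoidUniqueP.cartesianProductWith⁺ setoid (≋-setoid k) (≋-setoid (suc k)) (λ x v → x VF.∷ v)
      (λ eq → eq Fin.zero , λ i → eq (Fin.suc i)) elems-unique (vecs-unique k)

  α-normalised : ∀ i → Normalised (α i)
  α-normalised i = All.lookup (all-filter normalised? (vecs m)) (∈-lookup i)

  α-injective : ∀ i j → i ≢ j → ¬ α i ≋ α j
  α-injective = lookup-distinct (≋-setoid m) (SetoidUniqueP.filter⁺ (≋-setoid m) normalised? (vecs-unique m))

  𝔄-complete : ∀ u → Normalised u → ∃ λ b → α b ≋ u
  𝔄-complete u normal = Any.index in-𝔄 , AnyP.lookup-index in-𝔄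
    where
      in-vecs : Any (_≋ u) (vecs m)
      in-vecs = vecs-complete m u
      in-𝔄 : Any (_≋ u) 𝔄
      in-𝔄 = [ (λ found → found)
             , (λ abnormal → ⊥-elim (abnormal (normalised-resp (λ i → sym (AnyP.lookup-result in-vecs i)) normal)))
             ]′ (AnyP.filter⁺ normalised? in-vecs)

  columns-independent : ∀ {i j} → i ≢ j → ∀ s s' → (∀ k → s * α i k + s' * α j k ≈ 0#) → s' ≈ 0#
  columns-independent {i} {j} i≢j s s' combination≈0 with s' ≟ 0#
  ... | yes s'≈0 = s'≈0
  ... | no s'≉0 =
    let (w , s'w≈1) = inv s' s'≉0
        proportional : ∀ k → α j k ≈ - (w * s) * α i k
        proportional k = begin
          α j k                ≈⟨ inverse-cancelˡ (α j k) s'w≈1 ⟨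
          w * (s' * α j k)     ≈⟨ *-congˡ (inverseʳ-unique _ _ (combination≈0 k)) ⟩
          w * (- (s * α i k))  ≈⟨ -‿distribʳ-* w (s * α i k) ⟨
          - (w * (s * α i k))  ≈⟨ -‿cong (*-assoc w s (α i k)) ⟨
          - ((w * s) * α i k)  ≈⟨ -‿distribˡ-* (w * s) (α i k) ⟩
          - (w * s) * α i k    ∎
    in ⊥-elim (α-injective j i (≢-sym i≢j)
                (normalised-proportional _ (α-normalised j) (α-normalised i) proportional))

  column-not-combination : ∀ {i j} → i ≢ j → ∀ x y → (∀ k → α i k ≈ x * α i k + y * α j k) → y ≈ 0#
  column-not-combination {i} {j} i≢j x y αi≈ = columns-independent i≢j (x - 1#) y λ k → begin
    (x - 1#) * α i k + y * α j k           ≈⟨ +-congʳ (distribʳ (α i k) x (- 1#)) ⟩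
    (x * α i k + - 1# * α i k) + y * α j k ≈⟨ +-congʳ (+-congˡ (-1*x≈-x (α i k))) ⟩
    (x * α i k - α i k) + y * α j k        ≈⟨ xy∙z≈xz∙y (x * α i k) (- α i k) (y * α j k) ⟩
    (x * α i k + y * α j k) - α i k        ≈⟨ +-congʳ (αi≈ k) ⟨
    α i k - α i k                          ≈⟨ -‿inverseʳ (α i k) ⟩
    0#                                     ∎

  sumOver : List (Fin n) → (Fin n → Carrier) → Carrier
  sumOver is f = foldr (λ i s → f i + s) 0# is

  sumOver-cong : ∀ is {f g} → (∀ i → f i ≈ g i) → sumOver is f ≈ sumOver is g
  sumOver-cong []       f≈g = refl
  sumOver-cong (i ∷ is) f≈g = +-cong (f≈g i) (sumOver-cong is f≈g)

  sumOver-+ : ∀ is (f g : Fin n → Carrier) → sumOver is (λ i → f i + g i) ≈ sumOver is f + sumOver is g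
  sumOver-+ []       f g = sym (+-identityʳ 0#)
  sumOver-+ (i ∷ is) f g =
    trans (+-congˡ (sumOver-+ is f g)) (interchange (f i) (g i) (sumOver is f) (sumOver is g))

  sumOver-* : ∀ is a (f : Fin n → Carrier) → sumOver is (λ i → a * f i) ≈ a * sumOver is f
  sumOver-* []       a f = sym (zeroʳ a)
  sumOver-* (i ∷ is) a f = trans (+-congˡ (sumOver-* is a f)) (sym (distribˡ a (f i) (sumOver is f)))

  sumOver-zero : ∀ {is f} → All (λ i → f i ≈ 0#) is → sumOver is f ≈ 0#
  sumOver-zero []           = refl
  sumOver-zero (fi≈0 ∷ f≈0) = trans (+-cong fi≈0 (sumOver-zero f≈0)) (+-identityʳ 0#)

  e-self : ∀ d → e d d ≈ 1#
  e-self d with d FinP.≟ d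
  ... | yes _   = refl
  ... | no d≢d = ⊥-elim (d≢d ≡.refl)

  e-other : ∀ {d i} → d ≢ i → e d i ≈ 0#
  e-other {d} {i} d≢i with d FinP.≟ i
  ... | yes d≡i = ⊥-elim (d≢i d≡i)
  ... | no _    = refl

  sumOver-unit : ∀ {is} d (f : Fin n → Carrier) → Unique is → d ∈ is → sumOver is (λ i → e d i * f i) ≈ f d
  sumOver-unit {d ∷ is} d f (d∉is ∷ _) (here ≡.refl) =
    trans (+-cong (trans (*-congʳ (e-self d)) (*-identityˡ (f d)))
                  (sumOver-zero {f = λ i → e d i * f i}
                     (All.map (λ {i} d≢i → trans (*-congʳ (e-other d≢i)) (zeroˡ (f i))) d∉is)))
          (+-identityʳ (f d))
  sumOver-unit {i ∷ is} d f (i∉is ∷ is!) (there d∈is) =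
    trans (+-cong (trans (*-congʳ (e-other d≢i)) (zeroˡ (f i))) (sumOver-unit d f is! d∈is))
          (+-identityˡ (f d))
    where
      d≢i : d ≢ i
      d≢i d≡i = All.lookup i∉is d∈is (≡.sym d≡i)

  syndrome-⊕ : ∀ u w j → syndrome (u ⊕ w) j ≈ syndrome u j + syndrome w j
  syndrome-⊕ u w j = trans (sumOver-cong (allFin n) (λ i → distribʳ (α i j) (u i) (w i)))
                           (sumOver-+ (allFin n) _ _)

  syndrome-· : ∀ a u j → syndrome (a · u) j ≈ a * syndrome u j
  syndrome-· a u j = trans (sumOver-cong (allFin n) (λ i → *-assoc a (u i) (α i j)))
                           (sumOver-* (allFin n) a _)

  syndrome-e : ∀ d j → syndrome (e d) j ≈ α d j
  syndrome-e d j = sumOver-unit d (λ i → α i j) (allFin⁺ n) (∈-allFin d)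

  threeTerm : Fin n → Fin n → Fin n → Carrier → Carrier → Word
  threeTerm d₁ d₂ d₃ β γ = (e d₁ ⊕ (β · e d₂)) ⊕ (γ · e d₃)

  threeTerm-syndrome : ∀ d₁ d₂ d₃ β γ j →
    syndrome (threeTerm d₁ d₂ d₃ β γ) j ≈ (α d₁ j + β * α d₂ j) + γ * α d₃ j
  threeTerm-syndrome d₁ d₂ d₃ β γ j = begin
    syndrome ((e d₁ ⊕ (β · e d₂)) ⊕ (γ · e d₃)) j
      ≈⟨ syndrome-⊕ _ _ j ⟩
    syndrome (e d₁ ⊕ (β · e d₂)) j + syndrome (γ · e d₃) j
      ≈⟨ +-cong (syndrome-⊕ _ _ j) (syndrome-· γ (e d₃) j) ⟩
    (syndrome (e d₁) j + syndrome (β · e d₂) j) + γ * syndrome (e d₃) j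
      ≈⟨ +-congʳ (+-congˡ (syndrome-· β (e d₂) j)) ⟩
    (syndrome (e d₁) j + β * syndrome (e d₂) j) + γ * syndrome (e d₃) j
      ≈⟨ +-cong (+-cong (syndrome-e d₁ j) (*-congˡ (syndrome-e d₂ j))) (*-congˡ (syndrome-e d₃ j)) ⟩
    (α d₁ j + β * α d₂ j) + γ * α d₃ j
      ∎

  -- Key construction: for δ ≢ a and β ≠ 0 the vector α_δ + β α_a is nonzero,
  -- hence a nonzero multiple s (α_δ + β α_a) is a column α_b, and
  -- ē^(δ) + β ē^(a) - s⁻¹ ē^(b) is a codeword; b ∉ {δ, a} by independence.
  threeTerm-codeword : ∀ {δ a} → δ ≢ a → ∀ β → ¬ β ≈ 0# →
    ∃ λ b → ∃ λ γ → δ ≢ b × a ≢ b × ¬ γ ≈ 0# × InHamming (threeTerm δ a b β γ)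
  threeTerm-codeword {δ} {a} δ≢a β β≉0 =
    b , - s⁻¹ , δ≢b , a≢b , -‿nonzero (inverse-nonzero ss⁻¹≈1) , codeword
    where
      v : Vector Carrier m
      v k = α δ k + β * α a k

      v≠0 : ∃ λ k → ¬ v k ≈ 0#
      v≠0 = FinP.¬∀⟶∃¬ m (λ k → v k ≈ 0#) (λ k → v k ≟ 0#) λ v≈0 →
              β≉0 (columns-independent δ≢a 1# β (λ k → trans (+-congʳ (*-identityˡ (α δ k))) (v≈0 k)))

      scaled = normalise v (proj₁ v≠0) (proj₂ v≠0)
      s = proj₁ scaled
      s≉0 = proj₁ (proj₂ scaled)
      column = 𝔄-complete (λ k → s * v k) (proj₂ (proj₂ scaled))
      b = proj₁ column
      αb≈sv : ∀ k → α b k ≈ s * v k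
      αb≈sv = proj₂ column
      s⁻¹ = proj₁ (inv s s≉0)
      ss⁻¹≈1 : s * s⁻¹ ≈ 1#
      ss⁻¹≈1 = proj₂ (inv s s≉0)

      sv≈ : ∀ k → s * v k ≈ s * α δ k + (s * β) * α a k
      sv≈ k = trans (distribˡ s (α δ k) _) (+-congˡ (sym (*-assoc s β (α a k))))

      column-at : ∀ {d} → d ≡ b → ∀ k → α d k ≈ s * v k
      column-at ≡.refl = αb≈sv

      δ≢b : δ ≢ b
      δ≢b δ≡b = β≉0 (no-zero-divisors
        (column-not-combination δ≢a s (s * β) (λ k → trans (column-at δ≡b k) (sv≈ k))) s≉0)

      a≢b : a ≢ b
      a≢b a≡b = s≉0 (column-not-combination (≢-sym δ≢a) (s * β) s
                       (λ k → trans (column-at a≡b k) (trans (sv≈ k) (+-comm _ _))))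

      codeword : InHamming (threeTerm δ a b β (- s⁻¹))
      codeword j = begin
        syndrome (threeTerm δ a b β (- s⁻¹)) j ≈⟨ threeTerm-syndrome δ a b β (- s⁻¹) j ⟩
        v j + - s⁻¹ * α b j                   ≈⟨ +-congˡ (*-congˡ (αb≈sv j)) ⟩
        v j + - s⁻¹ * (s * v j)               ≈⟨ +-congˡ (-‿distribˡ-* s⁻¹ (s * v j)) ⟨
        v j - s⁻¹ * (s * v j)                 ≈⟨ +-congˡ (-‿cong (inverse-cancelˡ (v j) ss⁻¹≈1)) ⟩
        v j - v j                             ≈⟨ -‿inverseʳ (v j) ⟩
        0#                                    ∎

  module ThreeTerm {δ a b : Fin n} {β γ : Carrier} (δ≢a : δ ≢ a) (δ≢b : δ ≢ b) (a≢b : a ≢ b)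
                   (β≉0 : ¬ β ≈ 0#) (γ≉0 : ¬ γ ≈ 0#) where

    t : Word
    t = threeTerm δ a b β γ

    coordinate : ∀ i {p q r} → e δ i ≈ p → e a i ≈ q → e b i ≈ r → t i ≈ (p + β * q) + γ * r
    coordinate i eδ≈ ea≈ eb≈ = +-cong (+-cong eδ≈ (*-congˡ ea≈)) (*-congˡ eb≈)

    at-δ : t δ ≈ 1#
    at-δ = trans (coordinate δ (e-self δ) (e-other (≢-sym δ≢a)) (e-other (≢-sym δ≢b)))
                 (trans (+-cong (trans (+-congˡ (zeroʳ β)) (+-identityʳ 1#)) (zeroʳ γ)) (+-identityʳ 1#))

    at-a : t a ≈ β
    at-a = trans (coordinate a (e-other δ≢a) (e-self a) (e-other (≢-sym a≢b)))
                 (trans (+-cong (trans (+-identityˡ _) (*-identityʳ β)) (zeroʳ γ)) (+-identityʳ β))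

    at-b : t b ≈ γ
    at-b = trans (coordinate b (e-other δ≢b) (e-other a≢b) (e-self b))
                 (trans (+-cong (trans (+-identityˡ _) (zeroʳ β)) (*-identityʳ γ)) (+-identityˡ γ))

    elsewhere : ∀ {i} → i ≢ δ → i ≢ a → i ≢ b → t i ≈ 0#
    elsewhere {i} i≢δ i≢a i≢b =
      trans (coordinate i (e-other (≢-sym i≢δ)) (e-other (≢-sym i≢a)) (e-other (≢-sym i≢b)))
            (trans (+-cong (trans (+-identityˡ _) (zeroʳ β)) (zeroʳ γ)) (+-identityˡ 0#))

    InSupport : Fin n → Set
    InSupport i = i ≡ δ ⊎ (i ≡ a ⊎ i ≡ b)

    support⊆ : ∀ {i} → ¬ t i ≈ 0# → InSupport i
    support⊆ {i} ti≉0 with i FinP.≟ δ | i FinP.≟ a | i FinP.≟ b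
    ... | yes i≡δ | _       | _       = inj₁ i≡δ
    ... | no _    | yes i≡a | _       = inj₂ (inj₁ i≡a)
    ... | no _    | no _    | yes i≡b = inj₂ (inj₂ i≡b)
    ... | no i≢δ  | no i≢a  | no i≢b  = ⊥-elim (ti≉0 (elsewhere i≢δ i≢a i≢b))

    ⊆support : ∀ {i} → InSupport i → ¬ t i ≈ 0#
    ⊆support (inj₁ ≡.refl)        tδ≈0 = 0≉1 (trans (sym tδ≈0) at-δ)
    ⊆support (inj₂ (inj₁ ≡.refl)) ta≈0 = β≉0 (trans (sym at-a) ta≈0)
    ⊆support (inj₂ (inj₂ ≡.refl)) tb≈0 = γ≉0 (trans (sym at-b) tb≈0)

    weight≡3 : weight t ≡ 3
    weight≡3 =
      ≡.trans (≡.cong length (filter-≐ (λ i → ¬? (t i ≟ 0#)) inSupport? (support⊆ , ⊆support) (allFin n)))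
      (≡.trans (count-⊎ (FinP._≟ δ) _ δ∉ (allFin n))
      (≡.cong₂ ℕ._+_ (once δ)
        (≡.trans (count-⊎ (FinP._≟ a) (FinP._≟ b) a∉ (allFin n))
                 (≡.cong₂ ℕ._+_ (once a) (once b)))))
      where
        inSupport? : ∀ i → Dec (InSupport i)
        inSupport? i = (i FinP.≟ δ) ⊎-dec ((i FinP.≟ a) ⊎-dec (i FinP.≟ b))
        once : ∀ d → count (FinP._≟ d) (allFin n) ≡ 1
        once d = count-≡ FinP._≟_ (allFin⁺ n) (∈-allFin d)
        δ∉ : ∀ i → i ≡ δ → i ≡ a ⊎ i ≡ b → ⊥
        δ∉ i ≡.refl (inj₁ δ≡a) = δ≢a δ≡a
        δ∉ i ≡.refl (inj₂ δ≡b) = δ≢b δ≡b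
        a∉ : ∀ i → i ≡ a → i ≡ b → ⊥
        a∉ i ≡.refl a≡b = a≢b a≡b

    ∈T : InHamming t → T δ t
    ∈T codeword = codeword , weight≡3 , at-δ

  AgreeOff : Fin n → Word → Word → Set ℓ
  AgreeOff c x y = ∀ i → i ≢ c → x i ≈ y i

  agreeOff⇒dist≤1 : ∀ {x y} c → AgreeOff c x y → dist x y ≤ 1
  agreeOff⇒dist≤1 {x} {y} c agree =
    single-candidate⇒count≤1 (λ i → ¬? (x i ≟ y i)) (allFin⁺ n) c (λ i i≢c xi≉yi → xi≉yi (agree i i≢c))

  dist≤1⇒agreeOff : ∀ {x y} → Fin n → dist x y ≤ 1 → ∃ λ c → AgreeOff c x y
  dist≤1⇒agreeOff {x} {y} default dist≤1 =
    let (c , only-c) = count≤1⇒single-candidate (λ i → ¬? (x i ≟ y i)) default (allFin n) dist≤1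
    in c , λ i i≢c → decidable-stable (x i ≟ y i) (All.lookup only-c (∈-allFin i) i≢c)

  agreeOff-everywhere : ∀ {c x y} → AgreeOff c x y → x c ≈ y c → ∀ i → x i ≈ y i
  agreeOff-everywhere {c} agree xc≈yc i with i FinP.≟ c
  ... | yes ≡.refl = xc≈yc
  ... | no i≢c     = agree i i≢c

  module Shift (δ : Fin n) (μ : Carrier) (z z' : Word) (z'≈ : ∀ i → z' i ≈ z i + μ * e δ i)
               (x : Word) where

    Ω-intro : ∀ ts → All (λ p → T δ (proj₂ p)) ts → (c : Fin n) →
              AgreeOff c x (λ i → linComb ts i + z' i) → Ω (R δ +ˢ z') x
    Ω-intro ts ts∈T c agree =
      _ , (linComb ts , (ts , ts∈T , λ i → refl) , λ i → refl) , agreeOff⇒dist≤1 c agree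

    module _ (ts : List (Carrier × Word)) (ts∈T : All (λ p → T δ (proj₂ p)) ts)
             (y : Word) (y≈ : ∀ i → y i ≈ linComb ts i + z i) where

      shifted : ∀ i → linComb ts i + z' i ≈ y i + μ * e δ i
      shifted i = begin
        linComb ts i + z' i               ≈⟨ +-congˡ (z'≈ i) ⟩
        linComb ts i + (z i + μ * e δ i)  ≈⟨ +-assoc (linComb ts i) (z i) (μ * e δ i) ⟨
        (linComb ts i + z i) + μ * e δ i  ≈⟨ +-congʳ (y≈ i) ⟨
        y i + μ * e δ i                   ∎

      extended : ∀ ν t i → linComb ((ν , t) ∷ ts) i + z' i ≈ y i + (ν * t i + μ * e δ i)
      extended ν t i = begin
        (ν * t i + linComb ts i) + z' i               ≈⟨ +-congˡ (z'≈ i) ⟩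
        (ν * t i + linComb ts i) + (z i + μ * e δ i)  ≈⟨ +-congʳ (+-comm (ν * t i) (linComb ts i)) ⟩
        (linComb ts i + ν * t i) + (z i + μ * e δ i)  ≈⟨ interchange (linComb ts i) (ν * t i) (z i) _ ⟩
        (linComb ts i + z i) + (ν * t i + μ * e δ i)  ≈⟨ +-congʳ (y≈ i) ⟨
        y i + (ν * t i + μ * e δ i)                   ∎

      -- if x agrees with y off δ, the shift is absorbed by that coordinate
      agree-off-δ : AgreeOff δ x y → Ω (R δ +ˢ z') x
      agree-off-δ agree = Ω-intro ts ts∈T δ λ i i≢δ → sym (begin
        linComb ts i + z' i  ≈⟨ shifted i ⟩
        y i + μ * e δ i      ≈⟨ +-congˡ (trans (*-congˡ (e-other (≢-sym i≢δ))) (zeroʳ μ)) ⟩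
        y i + 0#             ≈⟨ +-identityʳ (y i) ⟩
        y i                  ≈⟨ agree i i≢δ ⟨
        x i                  ∎)

      zero-shift : ∀ {a} → μ ≈ 0# → AgreeOff a x y → Ω (R δ +ˢ z') x
      zero-shift {a} μ≈0 agree = Ω-intro ts ts∈T a λ i i≢a → sym (begin
        linComb ts i + z' i  ≈⟨ shifted i ⟩
        y i + μ * e δ i      ≈⟨ +-congˡ (trans (*-congʳ μ≈0) (zeroˡ (e δ i))) ⟩
        y i + 0#             ≈⟨ +-identityʳ (y i) ⟩
        y i                  ≈⟨ agree i i≢a ⟨
        x i                  ∎)

      -- The essential case: x differs from y by λ ≠ 0 at a ≠ δ and μ ≠ 0.
      -- With ν = -μ and β = λ/ν, a codeword t = ē^(δ) + β ē^(a) + γ ē^(b)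
      -- lies in T_δ, and y + ν t + μ ē^(δ) agrees with x off b.
      module Correction {a : Fin n} (a≢δ : a ≢ δ) (μ≉0 : ¬ μ ≈ 0#) (xa≉ya : ¬ x a ≈ y a)
                        (agree : AgreeOff a x y) where

        ν = - μ
        ν≉0 = -‿nonzero μ≉0
        ν⁻¹ = proj₁ (inv ν ν≉0)
        νν⁻¹≈1 : ν * ν⁻¹ ≈ 1#
        νν⁻¹≈1 = proj₂ (inv ν ν≉0)

        β = ν⁻¹ * (x a - y a)
        β≉0 : ¬ β ≈ 0#
        β≉0 β≈0 = xa≉ya (x∙y⁻¹≈ε⇒x≈y (x a) (y a) (no-zero-divisors β≈0 (inverse-nonzero νν⁻¹≈1)))

        δ≢a = ≢-sym a≢δ

        -- the argument works for any codeword of this shape; stating it for an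
        -- arbitrary b keeps the type checker from unfolding the search for b
        module _ {b γ} (δ≢b : δ ≢ b) (a≢b : a ≢ b) (γ≉0 : ¬ γ ≈ 0#)
                 (codeword : InHamming (threeTerm δ a b β γ)) where
          open ThreeTerm δ≢a δ≢b a≢b β≉0 γ≉0 using (t; at-δ; at-a; elsewhere; ∈T)

          corrected : ∀ i → i ≢ b → x i ≈ y i + (ν * t i + μ * e δ i)
          corrected i i≢b with i FinP.≟ δ | i FinP.≟ a
          ... | yes ≡.refl | _ = sym (begin
            y δ + (ν * t δ + μ * e δ δ)  ≈⟨ +-congˡ (+-cong (trans (*-congˡ at-δ) (*-identityʳ ν))
                                                           (trans (*-congˡ (e-self δ)) (*-identityʳ μ))) ⟩
            y δ + (- μ + μ)              ≈⟨ +-congˡ (-‿inverseˡ μ) ⟩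
            y δ + 0#                     ≈⟨ +-identityʳ (y δ) ⟩
            y δ                          ≈⟨ agree δ δ≢a ⟨
            x δ                          ∎)
          ... | no _ | yes ≡.refl = sym (begin
            y a + (ν * t a + μ * e δ a)  ≈⟨ +-congˡ (+-cong (*-congˡ at-a) (trans (*-congˡ (e-other δ≢a)) (zeroʳ μ))) ⟩
            y a + (ν * β + 0#)           ≈⟨ +-congˡ (trans (+-identityʳ (ν * β)) (inverse-cancelʳ _ νν⁻¹≈1)) ⟩
            y a + (x a - y a)            ≈⟨ x∙yz≈y∙xz (y a) (x a) (- y a) ⟩
            x a + (y a - y a)            ≈⟨ +-congˡ (-‿inverseʳ (y a)) ⟩
            x a + 0#                     ≈⟨ +-identityʳ (x a) ⟩
            x a                          ∎)
          ... | no i≢δ | no i≢a = sym (begin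
            y i + (ν * t i + μ * e δ i)  ≈⟨ +-congˡ (+-cong (trans (*-congˡ (elsewhere i≢δ i≢a i≢b)) (zeroʳ ν))
                                                           (trans (*-congˡ (e-other (≢-sym i≢δ))) (zeroʳ μ))) ⟩
            y i + (0# + 0#)              ≈⟨ +-congˡ (+-identityʳ 0#) ⟩
            y i + 0#                     ≈⟨ +-identityʳ (y i) ⟩
            y i                          ≈⟨ agree i i≢a ⟨
            x i                          ∎)

          via-codeword : Ω (R δ +ˢ z') x
          via-codeword = Ω-intro ((ν , t) ∷ ts) (∈T codeword ∷ ts∈T) b
                           (λ i i≢b → trans (corrected i i≢b) (sym (extended ν t i)))

        result : Ω (R δ +ˢ z') x
        result = let (_ , _ , δ≢b , a≢b , γ≉0 , codeword) = threeTerm-codeword δ≢a β β≉0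
                 in via-codeword δ≢b a≢b γ≉0 codeword

      shifted-neighbour : ∀ a → AgreeOff a x y → Ω (R δ +ˢ z') x
      shifted-neighbour a agree with a FinP.≟ δ | μ ≟ 0# | x a ≟ y a
      ... | yes ≡.refl | _        | _         = agree-off-δ agree
      ... | no _       | yes μ≈0  | _         = zero-shift μ≈0 agree
      ... | no _       | no _     | yes xa≈ya = agree-off-δ (λ i _ → agreeOff-everywhere agree xa≈ya i)
      ... | no a≢δ     | no μ≉0   | no xa≉ya  = Correction.result a≢δ μ≉0 xa≉ya agree

  shift : ∀ δ μ z z' → (∀ i → z' i ≈ z i + μ * e δ i) → ∀ x → Ω (R δ +ˢ z) x → Ω (R δ +ˢ z') x
  shift δ μ z z' z'≈ x (y , (r , (ts , ts∈T , r≈) , y≈) , dist≤1) =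
    let (a , agree) = dist≤1⇒agreeOff δ dist≤1
    in Shift.shifted-neighbour δ μ z z' z'≈ x ts ts∈T y (λ i → trans (y≈ i) (+-congʳ (r≈ i))) a agree

  unshift : ∀ δ μ (z : Word) i → z i ≈ (z i + μ * e δ i) + - μ * e δ i
  unshift δ μ z i = sym (begin
    (z i + μ * e δ i) + - μ * e δ i     ≈⟨ +-congˡ (-‿distribˡ-* μ (e δ i)) ⟨
    (z i + μ * e δ i) + - (μ * e δ i)   ≈⟨ +-assoc (z i) _ _ ⟩
    z i + (μ * e δ i + - (μ * e δ i))   ≈⟨ +-congˡ (-‿inverseʳ (μ * e δ i)) ⟩
    z i + 0#                            ≈⟨ +-identityʳ (z i) ⟩
    z i                                 ∎)

lemma1 : {c ℓ : Level} (F : FiniteField c ℓ) (m : ℕ) → 2 ≤ m →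
    let open FiniteField F using (Carrier)
        open Hamming F m
    in (δ : Fin n) (z : Word) (μ : Carrier) (x : Word) →
       Ω (R δ +ˢ z) x ⇔ Ω (R δ +ˢ (z ⊕ (μ · e δ))) x
lemma1 F m _ δ z μ x =
  mk⇔ (shift δ μ z _ (λ i → refl) x)
      (shift δ (- μ) _ z (unshift δ μ z) x)
  where
    open FiniteField F using (refl; -_)
    open CosetNeighbourhoods F m
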